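{- Let $\sigma$ be a partition of a positive integer $r$, let $n,q$ be positive integers, let $H=H(n,r,q\mid\sigma)$, and let $\beta \geq \alpha \geq 2$ be integers with $\alpha \leq s(\sigma) \leq \beta$. Then the $(\alpha,\beta)$-monochromatic zone of $H$ is exactly the set of all integers $k$ with \[ \left\lceil \frac{ n-\left(s(\sigma)-1- (\alpha -1) \left\lfloor \frac{s(\sigma)-1}{\alpha -1} \right\rfloor\right) }{ \left\lfloor \frac{s(\sigma) - 1}{\alpha - 1} \right\rfloor } \right\rceil \leq k \leq n. \]
   Context: For a partition $\sigma$ of $r$ and positive integers $n,q$, the $\sigma$-hypergraph $H(n,r,q\mid\sigma)$ is the $r$-uniform hypergraph whose vertex set has $nq$ vertices partitioned into $n$ classes $V_1,\dots,V_n$ of $q$ vertices each, and in which an $r$-subset $K$ of the vertex set is an edge if and only if the multiset of non-zero cardinalities $|K\cap V_i|$, $1\le i\le n$, is exactly the partition $\sigma$. $s(\sigma)$ denotes the number of parts of $\sigma$. For integers $\alpha\le\beta$, an $(\alpha,\beta)$-colouring of a hypergraph is an assignment of colours to its vertices such that every edge contains at least $\alpha$ and at most $\beta$ distinct colours; a $k$-$(\alpha,\beta)$-colouring is one using exactly $k$ colours. The $(\alpha,\beta)$-monochromatic zone of a $\sigma$-hypergraph is the set of all integers $k$ for which there exists a $k$-$(\alpha,\beta)$-colouring in which every class $V_i$ is monochromatic (all its vertices receive the same colour). -}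

module Defs where

open import Data.Nat using (ℕ; zero; suc; _+_; _*_; _∸_; _≤_; _≤?_)
open import Data.Nat.DivMod using (_/_)
open import Data.List using (List; map; filter; length; allFin)
open import Data.Nat.ListAction using (sum)
open import Data.List.Relation.Unary.All using (All)
open import Data.List.Relation.Binary.Permutation.Propositional using (_↭_)
open import Data.Fin using (Fin; _≟_)
open import Data.Fin.Properties using (any?)
open import Data.Fin.Subset using (Subset; _∈_; ∣_∣)
open import Data.Fin.Subset.Properties using (_∈?_)
open import Data.Vec using (tabulate)
open import Data.Product using (_×_; Σ; ∃)
open import Relation.Nullary using (does)
open import Relation.Nullary.Decidable using (_×-dec_)
open import Relation.Binary.PropositionalEquality using (_≡_)

IsPartition : List ℕ → ℕ → Set
IsPartition σ r = All (λ x → 1 ≤ x) σ × sum σ ≡ r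

s : List ℕ → ℕ
s σ = length σ

-- Vertex set of H(n,r,q|σ): pairs (i , j) with i : Fin n the class index and
-- j : Fin q the position inside class V_i.  A vertex subset K is given
-- class-wise: K i is the subset K ∩ V_i of V_i.
VSubset : ℕ → ℕ → Set
VSubset n q = Fin n → Subset q

nonzeroCards : ∀ {n q} → VSubset n q → List ℕ
nonzeroCards {n} K = filter (λ x → 1 ≤? x) (map (λ i → ∣ K i ∣) (allFin n))

card : ∀ {n q} → VSubset n q → ℕ
card {n} K = sum (map (λ i → ∣ K i ∣) (allFin n))

-- K is an edge of H(n,r,q|σ): an r-subset whose multiset of non-zero
-- intersection sizes is exactly σ (equality of multisets = permutation).
IsEdge : (n r q : ℕ) → List ℕ → VSubset n q → Set
IsEdge n r q σ K = card K ≡ r × nonzeroCards K ↭ σ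

Colouring : ℕ → ℕ → ℕ → Set
Colouring n q k = Fin n → Fin q → Fin k

usedColours : ∀ {n q k} → Colouring n q k → VSubset n q → Subset k
usedColours {n} {q} col K =
  tabulate (λ c → does (any? (λ i → any? (λ j → (j ∈? K i) ×-dec (col i j ≟ c)))))

numColours : ∀ {n q k} → Colouring n q k → VSubset n q → ℕ
numColours col K = ∣ usedColours col K ∣

ClassMonochromatic : ∀ {n q k} → Colouring n q k → Set
ClassMonochromatic {n} {q} col = ∀ (i : Fin n) (j j′ : Fin q) → col i j ≡ col i j′

-- a k-(α,β)-colouring of H(n,r,q|σ): uses exactly k colours (surjective onto
-- Fin k) and every edge sees between α and β distinct colours.
IsKAlphaBetaColouring : (n r q : ℕ) → List ℕ → (k α β : ℕ) → Colouring n q k → Set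
IsKAlphaBetaColouring n r q σ k α β col =
  (∀ c → ∃ λ (v : Fin n × Fin q) → col (Data.Product.proj₁ v) (Data.Product.proj₂ v) ≡ c)
  × (∀ (K : VSubset n q) → IsEdge n r q σ K → α ≤ numColours col K × numColours col K ≤ β)

InMonoZone : (n r q : ℕ) → List ℕ → (α β k : ℕ) → Set
InMonoZone n r q σ α β k =
  Σ (Colouring n q k) λ col → IsKAlphaBetaColouring n r q σ k α β col × ClassMonochromatic col

-- ceiling division ⌈ a / b ⌉ (b = 0 gives 0; never used with b = 0)
ceilDiv : ℕ → ℕ → ℕ
ceilDiv a zero = 0
ceilDiv a (suc b) = (a + b) / suc b

-- floor division ⌊ a / b ⌋ (b = 0 gives 0; never used with b = 0)
floorDiv : ℕ → ℕ → ℕ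
floorDiv a zero = 0
floorDiv a (suc b) = a / suc b

lowerBound : (n s α : ℕ) → ℕ
lowerBound n s α =
  ceilDiv (n ∸ ((s ∸ 1) ∸ (α ∸ 1) * floorDiv (s ∸ 1) (α ∸ 1))) (floorDiv (s ∸ 1) (α ∸ 1))

-- Colour the classes by f : Fin n → Fin k.  An edge touches exactly s = s(σ) classes and any
-- s classes are touched by some edge, so the class-monochromatic k-(α,β)-colourings are the onto
-- maps f under which no α − 1 colours cover s classes; the upper bound β ≥ s is automatic.
-- Write d = α − 1 and s − 1 = d m + R with R < d.  The colour classes then have sizes summing
-- to n, any d of which sum to at most d m + R, and such sizes exist iff k ≤ n ≤ k m + R.  If
-- n > k m + R, then either d classes have more than m elements, or the classes with more than m
-- elements, padded to d classes, leave k − d classes of size at most m behind; either way these d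
-- classes are too large.  Conversely, the balanced sizes ⌊n/k⌋ and ⌈n/k⌉ work.  Finally,
-- n ≤ k m + R is the ceiling bound of the statement.

module Submission where

open import Defs
open import Data.Bool using (Bool; true; false; not; T; if_then_else_)
open import Data.Bool.Properties using (T-≡)
open import Data.Empty using (⊥-elim)
open import Data.Fin using (Fin; zero; suc; toℕ; _↑ˡ_; _↑ʳ_)
open import Data.Fin.Properties using (_≟_; any?)
open import Data.Fin.Subset using (Subset; _∈_; ∣_∣; ⊥; inside)
open import Data.Fin.Subset.Properties using (_∈?_; ∣⊥∣≡0; ∉⊥)
open import Data.List using (List; []; _∷_; length; filter; map; allFin; tabulate)
open import Data.List.Properties using (map-tabulate; filter-none)
open import Data.List.Relation.Unary.All using (All; _∷_)
open import Data.List.Relation.Unary.All.Properties using (tabulate⁺)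
open import Data.List.Relation.Binary.Permutation.Propositional using (↭-reflexive)
open import Data.List.Relation.Binary.Permutation.Propositional.Properties using (↭-length)
open import Data.Nat using (ℕ; zero; suc; _+_; _*_; _∸_; _≤_; _<_; z≤n; s≤s; _<ᵇ_; NonZero)
open import Data.Nat.DivMod using (_/_; _%_; m≡m%n+[m/n]*n; m%n≡m∸m/n*n; m%n<n; m≥n⇒m/n>0; m/n*n≤m; m<n*o⇒m/o<n)
import Data.Nat.ListAction as List
open import Data.Nat.Properties hiding (_≟_)
open import Algebra.Properties.Semiring.Sum +-*-semiring
  using (sum; sum-cong-≗; ∑-comm; ∑-distrib-+; *-distribʳ-sum)
open import Data.Product using (∃; ∃₂; _×_; _,_; proj₁; proj₂)
open import Data.Unit using (tt)
open import Data.Vec using ([]; _∷_; lookup)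
open import Data.Vec.Properties using (lookup∘tabulate; []=⇒lookup; lookup⇒[]=)
import Data.Vec.Functional as Vector
open import Data.Vec.Functional.Properties using (lookup-++ˡ; lookup-++ʳ)
open import Function using (_∘_; id)
open import Function.Bundles using (_⇔_; mk⇔; Equivalence)
open import Function.Properties.Equivalence using () renaming (trans to ⇔-trans)
open import Relation.Binary.PropositionalEquality
open import Relation.Nullary using (¬_; does; yes; no; Dec; contradiction; _×-dec_)
open import Relation.Nullary.Decidable using (dec-true)

-- Counting subsets of Fin k

𝟙 : Bool → ℕ
𝟙 true  = 1
𝟙 false = 0

𝟙-≤1 : ∀ b → 𝟙 b ≤ 1
𝟙-≤1 true  = ≤-refl
𝟙-≤1 false = z≤n

T⇒1≤𝟙 : ∀ {b} → T b → 1 ≤ 𝟙 b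
T⇒1≤𝟙 {true} _ = ≤-refl

𝟙-mono : ∀ {a b} → (T a → T b) → 𝟙 a ≤ 𝟙 b
𝟙-mono {false} _   = z≤n
𝟙-mono {true}  a⇒b = T⇒1≤𝟙 (a⇒b tt)

𝟙-complement : ∀ b → 𝟙 b + 𝟙 (not b) ≡ 1
𝟙-complement true  = refl
𝟙-complement false = refl

does⇒ : ∀ {P : Set} (P? : Dec P) → T (does P?) → P
does⇒ (yes p) _ = p

⇒does : ∀ {P : Set} (P? : Dec P) → P → T (does P?)
⇒does (yes _) _ = tt
⇒does (no ¬p) p = ¬p p

count : ∀ {k} → (Fin k → Bool) → ℕ
count u = sum (𝟙 ∘ u)

sumOn : ∀ {k} → (Fin k → Bool) → (Fin k → ℕ) → ℕ
sumOn W z = sum (λ c → 𝟙 (W c) * z c)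

infix 4 _⊆ᵇ_
_⊆ᵇ_ : ∀ {k} → (Fin k → Bool) → (Fin k → Bool) → Set
u ⊆ᵇ v = ∀ i → T (u i) → T (v i)

sum-mono-≤ : ∀ {k} {f g : Fin k → ℕ} → (∀ i → f i ≤ g i) → sum f ≤ sum g
sum-mono-≤ {zero}  f≤g = z≤n
sum-mono-≤ {suc k} f≤g = +-mono-≤ (f≤g zero) (sum-mono-≤ (f≤g ∘ suc))

term≤sum : ∀ {k} (f : Fin k → ℕ) i → f i ≤ sum f
term≤sum f zero    = m≤m+n (f zero) _
term≤sum f (suc i) = ≤-trans (term≤sum (f ∘ suc) i) (m≤n+m _ (f zero))

sum-const : ∀ k m → sum {k} (λ _ → m) ≡ k * m
sum-const zero    m = refl
sum-const (suc k) m = cong (m +_) (sum-const k m)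

sum-split : ∀ a b (g : Fin (a + b) → ℕ) → sum g ≡ sum (g ∘ (_↑ˡ b)) + sum (g ∘ (a ↑ʳ_))
sum-split zero    b g = refl
sum-split (suc a) b g = trans (cong (g zero +_) (sum-split a b (g ∘ suc))) (sym (+-assoc (g zero) _ _))

count-all : ∀ k → count {k} (λ _ → true) ≡ k
count-all k = trans (sum-const k 1) (*-identityʳ k)

count-none : ∀ k → count {k} (λ _ → false) ≡ 0
count-none k = trans (sum-const k 0) (*-zeroʳ k)

count-mono : ∀ {k} {u v : Fin k → Bool} → u ⊆ᵇ v → count u ≤ count v
count-mono u⊆v = sum-mono-≤ (𝟙-mono ∘ u⊆v)

count-witness : ∀ {k} (u : Fin k → Bool) → 0 < count u → ∃ λ i → T (u i)
count-witness {suc k} u pos with u zero in u₀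
... | true  = zero , Equivalence.from T-≡ u₀
... | false with count-witness (u ∘ suc) pos
... | i , ui = suc i , ui

count-complement : ∀ {k} (W : Fin k → Bool) → count W + count (not ∘ W) ≡ k
count-complement {k} W = begin
  count W + count (not ∘ W)     ≡⟨ ∑-distrib-+ (𝟙 ∘ W) (𝟙 ∘ not ∘ W) ⟨
  sum (λ c → 𝟙 (W c) + 𝟙 (not (W c))) ≡⟨ sum-cong-≗ (𝟙-complement ∘ W) ⟩
  count {k} (λ _ → true)        ≡⟨ count-all k ⟩
  k                             ∎
  where open ≡-Reasoning

sumOn-complement : ∀ {k} (W : Fin k → Bool) (z : Fin k → ℕ) → sumOn W z + sumOn (not ∘ W) z ≡ sum z
sumOn-complement W z = begin
  sumOn W z + sumOn (not ∘ W) z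
    ≡⟨ ∑-distrib-+ (λ c → 𝟙 (W c) * z c) (λ c → 𝟙 (not (W c)) * z c) ⟨
  sum (λ c → 𝟙 (W c) * z c + 𝟙 (not (W c)) * z c)
    ≡⟨ sum-cong-≗ split ⟩
  sum z ∎
  where
  open ≡-Reasoning
  split : ∀ c → 𝟙 (W c) * z c + 𝟙 (not (W c)) * z c ≡ z c
  split c = trans (sym (*-distribʳ-+ (z c) (𝟙 (W c)) _))
                  (trans (cong (_* z c) (𝟙-complement (W c))) (*-identityˡ (z c)))

sumOn-all : ∀ {k} (z : Fin k → ℕ) → sumOn (λ _ → true) z ≡ sum z
sumOn-all z = sum-cong-≗ (λ c → *-identityˡ (z c))

count*≡sumOn : ∀ {k} (W : Fin k → Bool) m → count W * m ≡ sumOn W (λ _ → m)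
count*≡sumOn W m = *-distribʳ-sum m (𝟙 ∘ W)

sumOn-≤ : ∀ {k} (W : Fin k → Bool) (z : Fin k → ℕ) m →
  (∀ c → T (W c) → z c ≤ m) → sumOn W z ≤ count W * m
sumOn-≤ W z m z≤m = subst (sumOn W z ≤_) (sym (count*≡sumOn W m)) (sum-mono-≤ bound)
  where
  bound : ∀ c → 𝟙 (W c) * z c ≤ 𝟙 (W c) * m
  bound c with W c | z≤m c
  ... | true  | h = *-monoʳ-≤ 1 (h tt)
  ... | false | _ = z≤n

sumOn-≥ : ∀ {k} (W : Fin k → Bool) (z : Fin k → ℕ) m →
  (∀ c → T (W c) → m ≤ z c) → count W * m ≤ sumOn W z
sumOn-≥ W z m m≤z = subst (_≤ sumOn W z) (sym (count*≡sumOn W m)) (sum-mono-≤ bound)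
  where
  bound : ∀ c → 𝟙 (W c) * m ≤ 𝟙 (W c) * z c
  bound c with W c | m≤z c
  ... | true  | h = *-monoʳ-≤ 1 (h tt)
  ... | false | _ = z≤n

sumOn-+-≤ : ∀ {k} (W : Fin k → Bool) x (y : Fin k → ℕ) → sumOn W (λ c → x + y c) ≤ count W * x + sum y
sumOn-+-≤ W x y = begin
  sumOn W (λ c → x + y c)                    ≤⟨ sum-mono-≤ (λ c → split (W c) (y c)) ⟩
  sum (λ c → 𝟙 (W c) * x + y c)             ≡⟨ ∑-distrib-+ (λ c → 𝟙 (W c) * x) y ⟩
  sumOn W (λ _ → x) + sum y                  ≡⟨ cong (_+ sum y) (count*≡sumOn W x) ⟨
  count W * x + sum y                        ∎
  where
  open ≤-Reasoning
  split : ∀ b v → 𝟙 b * (x + v) ≤ 𝟙 b * x + v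
  split true  v = ≤-reflexive (trans (*-identityˡ (x + v)) (cong (_+ v) (sym (*-identityˡ x))))
  split false v = z≤n

subsetOfSize : ∀ {k} (v : Fin k → Bool) a → a ≤ count v → ∃ λ w → w ⊆ᵇ v × count w ≡ a
subsetOfSize {k} v zero _ = (λ _ → false) , (λ _ ()) , count-none k
subsetOfSize {suc k} v (suc a) a<v with v zero in v₀
... | true with subsetOfSize (v ∘ suc) a (≤-pred a<v)
...   | w , w⊆v , #w =
  (true Vector.∷ w) , (λ { zero _ → Equivalence.from T-≡ v₀ ; (suc i) → w⊆v i }) , cong suc #w
subsetOfSize {suc k} v (suc a) a<v | false with subsetOfSize (v ∘ suc) (suc a) a<v
...   | w , w⊆v , #w =
  (false Vector.∷ w) , (λ { zero () ; (suc i) → w⊆v i }) , #w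

count-not : ∀ {k} (W : Fin k → Bool) → count (not ∘ W) ≡ k ∸ count W
count-not {k} W = trans (sym (m+n∸m≡n (count W) _)) (cong (_∸ count W) (count-complement W))

supersetOfSize : ∀ {k} (u : Fin k → Bool) a → count u ≤ a → a ≤ k → ∃ λ w → u ⊆ᵇ w × count w ≡ a
supersetOfSize {k} u a u≤a a≤k = not ∘ w , u⊆∁w , #∁w
  where
  room : k ∸ a ≤ count (not ∘ u)
  room = subst (k ∸ a ≤_) (sym (count-not u)) (∸-monoʳ-≤ k u≤a)
  chosen = subsetOfSize (not ∘ u) (k ∸ a) room
  w = proj₁ chosen
  w⊆∁u = proj₁ (proj₂ chosen)
  u⊆∁w : u ⊆ᵇ not ∘ w
  u⊆∁w i ui with w i | w⊆∁u i
  ... | false | _   = tt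
  ... | true  | ∁ui with u i
  ...   | true = ∁ui tt
  #∁w : count (not ∘ w) ≡ a
  #∁w = trans (count-not w) (trans (cong (k ∸_) (proj₂ (proj₂ chosen))) (m∸[m∸n]≡n a≤k))

-- Fibres of maps Fin n → Fin k

fibreSize : ∀ {n k} → (Fin n → Fin k) → Fin k → ℕ
fibreSize f c = count (λ i → does (f i ≟ c))

sum-δ : ∀ {k} (x : Fin k) y → sum (λ c → 𝟙 (does (x ≟ c)) * y) ≡ y
sum-δ {suc k} zero    y = trans (cong₂ _+_ (+-identityʳ y) (trans (sum-const k 0) (*-zeroʳ k))) (+-identityʳ y)
sum-δ {suc k} (suc x) y = sum-δ x y

sum-byFibres : ∀ {n k} (f : Fin n → Fin k) (g : Fin n → ℕ) →
  sum g ≡ sum (λ c → sum (λ i → 𝟙 (does (f i ≟ c)) * g i))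
sum-byFibres f g = trans (sum-cong-≗ (λ i → sym (sum-δ (f i) (g i)))) (∑-comm (λ i c → 𝟙 (does (f i ≟ c)) * g i))

count-preimage : ∀ {n k} (f : Fin n → Fin k) (W : Fin k → Bool) → count (W ∘ f) ≡ sumOn W (fibreSize f)
count-preimage f W = begin
  count (W ∘ f)
    ≡⟨ sum-byFibres f (𝟙 ∘ W ∘ f) ⟩
  sum (λ c → sum (λ i → 𝟙 (does (f i ≟ c)) * 𝟙 (W (f i))))
    ≡⟨ sum-cong-≗ (λ c → sum-cong-≗ (only-c c)) ⟩
  sum (λ c → sum (λ i → 𝟙 (does (f i ≟ c)) * 𝟙 (W c)))
    ≡⟨ sum-cong-≗ (λ c → *-distribʳ-sum (𝟙 (W c)) (λ i → 𝟙 (does (f i ≟ c)))) ⟨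
  sum (λ c → fibreSize f c * 𝟙 (W c))
    ≡⟨ sum-cong-≗ (λ c → *-comm (fibreSize f c) (𝟙 (W c))) ⟩
  sumOn W (fibreSize f) ∎
  where
  open ≡-Reasoning
  only-c : ∀ c i → 𝟙 (does (f i ≟ c)) * 𝟙 (W (f i)) ≡ 𝟙 (does (f i ≟ c)) * 𝟙 (W c)
  only-c c i with f i ≟ c
  ... | yes refl = refl
  ... | no  _    = refl

sum-fibreSize : ∀ {n k} (f : Fin n → Fin k) → sum (fibreSize f) ≡ n
sum-fibreSize {n} f = begin
  sum (fibreSize f)                   ≡⟨ sum-cong-≗ (λ c → *-identityˡ (fibreSize f c)) ⟨
  sumOn (λ _ → true) (fibreSize f)    ≡⟨ count-preimage f (λ _ → true) ⟨
  count {n} (λ _ → true)              ≡⟨ count-all n ⟩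
  n                                   ∎
  where open ≡-Reasoning

count-image-≤ : ∀ {n k} (f : Fin n → Fin k) (t : Fin n → Bool) (u : Fin k → Bool) →
  (∀ c → T (u c) → ∃ λ i → T (t i) × f i ≡ c) → count u ≤ count t
count-image-≤ f t u hit = ≤-trans (sum-mono-≤ hitOnce) (≤-reflexive (sym (sum-byFibres f (𝟙 ∘ t))))
  where
  selfTerm : ∀ i → T (t i) → 1 ≤ 𝟙 (does (f i ≟ f i)) * 𝟙 (t i)
  selfTerm i ti rewrite dec-true (f i ≟ f i) refl = ≤-trans (T⇒1≤𝟙 ti) (m≤m+n _ 0)
  hitOnce : ∀ c → 𝟙 (u c) ≤ sum (λ i → 𝟙 (does (f i ≟ c)) * 𝟙 (t i))
  hitOnce c with u c | hit c
  ... | false | _ = z≤n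
  ... | true  | h with h tt
  ... | i , ti , refl = ≤-trans (selfTerm i ti) (term≤sum (λ j → 𝟙 (does (f j ≟ f i)) * 𝟙 (t j)) i)

colourBlocks : ∀ {k} (z : Fin k → ℕ) → Fin (sum z) → Fin k
colourBlocks {suc k} z = Vector.replicate (z zero) zero Vector.++ (suc ∘ colourBlocks (z ∘ suc))

fibreSize-colourBlocks : ∀ {k} (z : Fin k → ℕ) c → fibreSize (colourBlocks z) c ≡ z c
fibreSize-colourBlocks {suc k} z c = begin
  fibreSize (colourBlocks z) c
    ≡⟨ sum-split (z zero) (sum (z ∘ suc)) (λ i → 𝟙 (does (colourBlocks z i ≟ c))) ⟩
  sum (λ j → 𝟙 (does (colourBlocks z (j ↑ˡ sum (z ∘ suc)) ≟ c)))
    + sum (λ j → 𝟙 (does (colourBlocks z (z zero ↑ʳ j) ≟ c)))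
    ≡⟨ cong₂ _+_ (sum-cong-≗ (λ j → cong (λ x → 𝟙 (does (x ≟ c))) (lookup-++ˡ first rest j)))
                 (sum-cong-≗ (λ j → cong (λ x → 𝟙 (does (x ≟ c))) (lookup-++ʳ first rest j))) ⟩
  sum {z zero} (λ _ → 𝟙 (does (zero ≟ c))) + fibreSize rest c
    ≡⟨ blocks c ⟩
  z c ∎
  where
  open ≡-Reasoning
  first : Fin (z zero) → Fin (suc k)
  first = Vector.replicate (z zero) zero
  rest : Fin (sum (z ∘ suc)) → Fin (suc k)
  rest = suc ∘ colourBlocks (z ∘ suc)
  blocks : ∀ c → sum {z zero} (λ _ → 𝟙 (does (zero ≟ c))) + fibreSize rest c ≡ z c
  blocks zero    = trans (cong₂ _+_ (count-all (z zero)) (count-none (sum (z ∘ suc))))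
                         (+-identityʳ (z zero))
  blocks (suc c) = trans (cong (_+ fibreSize rest (suc c)) (count-none (z zero)))
                         (fibreSize-colourBlocks (z ∘ suc) c)

realise : ∀ {n k} (z : Fin k → ℕ) → sum z ≡ n → ∃ λ (f : Fin n → Fin k) → ∀ c → fibreSize f c ≡ z c
realise z refl = colourBlocks z , fibreSize-colourBlocks z

-- Colour-class sizes

Capped : ∀ {k} → ℕ → ℕ → (Fin k → ℕ) → Set
Capped d b z = ∀ W → count W ≤ d → sumOn W z < b

heavyColourSet : ∀ {k} (z : Fin k → ℕ) d m R → R < d → d * m + R < sum z → k * m + R < sum z →
  ∃ λ W → count W ≤ d × d * m + R < sumOn W z
heavyColourSet {k} z d m R R<d dm+R<∑ km+R<∑ with d ≤? count (λ c → m <ᵇ z c) | d ≤? k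
... | yes d≤#heavy | _ = W , ≤-reflexive #W , (begin-strict
  d * m + R      <⟨ +-monoʳ-< (d * m) R<d ⟩
  d * m + d      ≡⟨ trans (+-comm (d * m) d) (sym (*-suc d m)) ⟩
  d * suc m      ≡⟨ cong (_* suc m) #W ⟨
  count W * suc m ≤⟨ sumOn-≥ W z (suc m) (λ c Wc → <ᵇ⇒< m (z c) (W⊆heavy c Wc)) ⟩
  sumOn W z      ∎)
  where
  open ≤-Reasoning
  chosen = subsetOfSize (λ c → m <ᵇ z c) d d≤#heavy
  W = proj₁ chosen
  W⊆heavy = proj₁ (proj₂ chosen)
  #W = proj₂ (proj₂ chosen)
... | no _ | no d≰k = (λ _ → true) , ≤-trans (≤-reflexive (count-all k)) (<⇒≤ (≰⇒> d≰k)) ,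
                      subst (d * m + R <_) (sym (sumOn-all z)) dm+R<∑
... | no d≰#heavy | yes d≤k = W , ≤-reflexive #W , +-cancelˡ-< (#∁W * m) (d * m + R) (sumOn W z) (begin-strict
  #∁W * m + (d * m + R)      ≡⟨ sizes ⟩
  k * m + R                  <⟨ km+R<∑ ⟩
  sum z                      ≡⟨ sumOn-complement W z ⟨
  sumOn W z + sumOn (not ∘ W) z ≤⟨ +-monoʳ-≤ (sumOn W z) (sumOn-≤ (not ∘ W) z m light) ⟩
  sumOn W z + #∁W * m        ≡⟨ +-comm (sumOn W z) (#∁W * m) ⟩
  #∁W * m + sumOn W z        ∎)
  where
  open ≤-Reasoning
  chosen = supersetOfSize (λ c → m <ᵇ z c) d (<⇒≤ (≰⇒> d≰#heavy)) d≤k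
  W = proj₁ chosen
  #W = proj₂ (proj₂ chosen)
  #∁W = count (not ∘ W)
  light : ∀ c → T (not (W c)) → z c ≤ m
  light c ∁Wc with m <? z c
  ... | no  m≮z = ≮⇒≥ m≮z
  ... | yes m<z with W c | proj₁ (proj₂ chosen) c (<⇒<ᵇ m<z)
  ... | true | _ = ⊥-elim ∁Wc
  sizes : #∁W * m + (d * m + R) ≡ k * m + R
  sizes = begin-equality
    #∁W * m + (d * m + R) ≡⟨ +-assoc (#∁W * m) (d * m) R ⟨
    #∁W * m + d * m + R   ≡⟨ cong (_+ R) (*-distribʳ-+ m #∁W d) ⟨
    (#∁W + d) * m + R     ≡⟨ cong (λ x → (#∁W + x) * m + R) #W ⟨
    (#∁W + count W) * m + R ≡⟨ cong (λ x → x * m + R) (trans (+-comm #∁W (count W)) (count-complement W)) ⟩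
    k * m + R             ∎

capped⇒sum≤ : ∀ {k} (z : Fin k → ℕ) d m R → R < d → d * m + R < sum z →
  Capped d (suc (d * m + R)) z → sum z ≤ k * m + R
capped⇒sum≤ z d m R R<d dm+R<∑ capped with sum z ≤? _
... | yes ∑≤ = ∑≤
... | no ∑≰ with heavyColourSet z d m R R<d dm+R<∑ (≰⇒> ∑≰)
... | W , #W≤d , heavy = contradiction (≤-pred (capped W #W≤d)) (<⇒≱ heavy)

balanced : (n k : ℕ) .{{_ : NonZero k}} → Fin k → ℕ
balanced n k c = n / k + 𝟙 (toℕ c <ᵇ n % k)

count-below : ∀ {k} a → a ≤ k → count {k} (λ c → toℕ c <ᵇ a) ≡ a
count-below {k}     zero    _       = count-none k
count-below {suc k} (suc a) (s≤s a≤k) = cong suc (count-below a a≤k)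

sum-balanced : ∀ n k .{{_ : NonZero k}} → sum (balanced n k) ≡ n
sum-balanced n k = begin
  sum (balanced n k)
    ≡⟨ ∑-distrib-+ {k} (λ _ → n / k) (λ c → 𝟙 (toℕ c <ᵇ n % k)) ⟩
  sum {k} (λ _ → n / k) + count {k} (λ c → toℕ c <ᵇ n % k)
    ≡⟨ cong₂ _+_ (sum-const k (n / k)) (count-below (n % k) (<⇒≤ (m%n<n n k))) ⟩
  k * (n / k) + n % k
    ≡⟨ trans (+-comm (k * (n / k)) (n % k)) (cong (n % k +_) (*-comm k (n / k))) ⟩
  n % k + n / k * k
    ≡⟨ m≡m%n+[m/n]*n n k ⟨
  n ∎
  where open ≡-Reasoning

balanced≤ : ∀ n k .{{_ : NonZero k}} c → balanced n k c ≤ suc (n / k)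
balanced≤ n k c = ≤-trans (+-monoʳ-≤ (n / k) (𝟙-≤1 (toℕ c <ᵇ n % k))) (≤-reflexive (+-comm (n / k) 1))

balanced-positive : ∀ n k .{{_ : NonZero k}} → k ≤ n → ∀ c → 0 < balanced n k c
balanced-positive n k k≤n c = ≤-trans (m≥n⇒m/n>0 k≤n) (m≤m+n (n / k) _)

balanced-capped : ∀ n k .{{_ : NonZero k}} d m R → R < k → n ≤ k * m + R →
  Capped d (suc (d * m + R)) (balanced n k)
balanced-capped n k d m R R<k n≤ W #W≤d = s≤s (bound (n / k <? m))
  where
  open ≤-Reasoning
  z = balanced n k
  bound : Dec (n / k < m) → sumOn W z ≤ d * m + R
  bound (yes q<m) = begin
    sumOn W z     ≤⟨ sumOn-≤ W z m (λ c _ → ≤-trans (balanced≤ n k c) q<m) ⟩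
    count W * m   ≤⟨ *-monoˡ-≤ m #W≤d ⟩
    d * m         ≤⟨ m≤m+n (d * m) R ⟩
    d * m + R     ∎
  bound (no q≮m) = begin
    sumOn W z
      ≤⟨ sumOn-+-≤ W (n / k) (λ c → 𝟙 (toℕ c <ᵇ n % k)) ⟩
    count W * (n / k) + count {k} (λ c → toℕ c <ᵇ n % k)
      ≡⟨ cong₂ _+_ (cong (count W *_) q≡m) (count-below (n % k) (<⇒≤ (m%n<n n k))) ⟩
    count W * m + n % k
      ≤⟨ +-mono-≤ (*-monoˡ-≤ m #W≤d) r≤R ⟩
    d * m + R ∎
    where
    q≤m : n / k ≤ m
    q≤m with m <? n / k
    ... | no  m≮q = ≮⇒≥ m≮q
    ... | yes m<q = contradiction R<k (≤⇒≯ (+-cancelˡ-≤ (k * m) k R (begin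
      k * m + k   ≡⟨ trans (+-comm (k * m) k) (sym (*-suc k m)) ⟩
      k * suc m   ≤⟨ *-monoʳ-≤ k m<q ⟩
      k * (n / k) ≡⟨ *-comm k (n / k) ⟩
      n / k * k   ≤⟨ m/n*n≤m n k ⟩
      n           ≤⟨ n≤ ⟩
      k * m + R   ∎)))
    q≡m : n / k ≡ m
    q≡m = ≤-antisym q≤m (≮⇒≥ q≮m)
    r≤R : n % k ≤ R
    r≤R = +-cancelʳ-≤ (k * m) (n % k) R (begin
      n % k + k * m     ≡⟨ cong (n % k +_) (trans (cong (k *_) (sym q≡m)) (*-comm k (n / k))) ⟩
      n % k + n / k * k ≡⟨ m≡m%n+[m/n]*n n k ⟨
      n                 ≤⟨ n≤ ⟩
      k * m + R         ≡⟨ +-comm (k * m) R ⟩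
      R + k * m         ∎)

-- Onto maps in which few colours cover few points

Onto : ∀ {n k} → (Fin n → Fin k) → Set
Onto f = ∀ c → ∃ λ i → f i ≡ c

Sparse : ∀ {n k} → ℕ → ℕ → (Fin n → Fin k) → Set
Sparse d b f = ∀ W → count W ≤ d → count (W ∘ f) < b

onto⇒≤ : ∀ {n k} (f : Fin n → Fin k) → Onto f → k ≤ n
onto⇒≤ {n} {k} f onto = subst₂ _≤_ (count-all k) (count-all n)
  (count-image-≤ f (λ _ → true) (λ _ → true) (λ c _ → let (i , fi≡c) = onto c in i , tt , fi≡c))

sparseSurjection⇒bounds : ∀ {n k} d m R → R < d → d * m + R < n →
  (f : Fin n → Fin k) → Onto f → Sparse d (suc (d * m + R)) f → k ≤ n × n ≤ k * m + R
sparseSurjection⇒bounds {k = k} d m R R<d dm+R<n f onto sparse = onto⇒≤ f onto ,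
  subst (_≤ k * m + R) (sum-fibreSize f)
    (capped⇒sum≤ (fibreSize f) d m R R<d (subst (d * m + R <_) (sym (sum-fibreSize f)) dm+R<n)
      (λ W #W≤d → subst (_< suc (d * m + R)) (count-preimage f W) (sparse W #W≤d)))

bounds⇒sparseSurjection : ∀ {n} k d m R → R < d → d * m + R < n → k ≤ n → n ≤ k * m + R →
  ∃ λ (f : Fin n → Fin k) → Onto f × Sparse d (suc (d * m + R)) f
bounds⇒sparseSurjection zero d m R R<d dm+R<n k≤n n≤ =
  contradiction (≤-trans (s≤s (m≤n+m R (d * m))) dm+R<n) (≤⇒≯ n≤)
bounds⇒sparseSurjection {n} k@(suc _) d m R R<d dm+R<n k≤n n≤ = f , onto , sparse
  where
  realised = realise (balanced n k) (sum-balanced n k)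
  f = proj₁ realised
  fibres = proj₂ realised
  onto : Onto f
  onto c = let (i , fi≡c) = count-witness (λ i → does (f i ≟ c))
                              (subst (0 <_) (sym (fibres c)) (balanced-positive n k k≤n c))
           in i , does⇒ (f i ≟ c) fi≡c
  d<k : d < k
  d<k = *-cancelʳ-< m d k (+-cancelʳ-< R (d * m) (k * m) (<-≤-trans dm+R<n n≤))
  sparse : Sparse d (suc (d * m + R)) f
  sparse W #W≤d = subst (_< suc (d * m + R))
    (sym (trans (count-preimage f W) (sum-cong-≗ (λ c → cong (𝟙 (W c) *_) (fibres c)))))
    (balanced-capped n k d m R (<-trans R<d d<k) n≤ W #W≤d)

-- Class colourings of H(n,r,q|σ)

∣p∣≡count : ∀ {q} (p : Subset q) → ∣ p ∣ ≡ count (lookup p)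
∣p∣≡count []          = refl
∣p∣≡count (true ∷ p)  = cong suc (∣p∣≡count p)
∣p∣≡count (false ∷ p) = ∣p∣≡count p

∈⇒∣p∣>0 : ∀ {q} {p : Subset q} {j} → j ∈ p → 0 < ∣ p ∣
∈⇒∣p∣>0 {p = p} {j} j∈p = subst (0 <_) (sym (∣p∣≡count p))
  (≤-trans (T⇒1≤𝟙 (Equivalence.from T-≡ ([]=⇒lookup j∈p))) (term≤sum (𝟙 ∘ lookup p) j))

∣p∣>0⇒∈ : ∀ {q} (p : Subset q) → 0 < ∣ p ∣ → ∃ λ j → j ∈ p
∣p∣>0⇒∈ p ∣p∣>0 with count-witness (lookup p) (subst (0 <_) (∣p∣≡count p) ∣p∣>0)
... | j , pj = j , lookup⇒[]= j p (Equivalence.to T-≡ pj)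

touched : ∀ {n q} → VSubset n q → Fin n → Bool
touched K i = does (1 ≤? ∣ K i ∣)

length-filter-tabulate : ∀ {n} (g : Fin n → ℕ) →
  length (filter (1 ≤?_) (tabulate g)) ≡ count (λ i → does (1 ≤? g i))
length-filter-tabulate {zero}  g = refl
length-filter-tabulate {suc n} g with g zero
... | zero  = length-filter-tabulate (g ∘ suc)
... | suc _ = cong suc (length-filter-tabulate (g ∘ suc))

count-touched : ∀ {n r q σ} (K : VSubset n q) → IsEdge n r q σ K → count (touched K) ≡ s σ
count-touched {σ = σ} K (_ , sizes↭σ) = begin
  count (touched K)
    ≡⟨ length-filter-tabulate (λ i → ∣ K i ∣) ⟨
  length (filter (1 ≤?_) (tabulate (λ i → ∣ K i ∣)))
    ≡⟨ cong (length ∘ filter (1 ≤?_)) (map-tabulate id (λ i → ∣ K i ∣)) ⟨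
  length (nonzeroCards K)
    ≡⟨ ↭-length sizes↭σ ⟩
  s σ ∎
  where open ≡-Reasoning

used : ∀ {n q k} → Colouring n q k → VSubset n q → Fin k → Bool
used col K = lookup (usedColours col K)

numColours≡count : ∀ {n q k} (col : Colouring n q k) K → numColours col K ≡ count (used col K)
numColours≡count col K = ∣p∣≡count (usedColours col K)

used⁺ : ∀ {n q k} (col : Colouring n q k) K {i j} → j ∈ K i → T (used col K (col i j))
used⁺ col K {i} {j} j∈Ki = subst T (sym (lookup∘tabulate _ (col i j)))
  (⇒does (any? (λ i′ → any? (λ j′ → (j′ ∈? K i′) ×-dec (col i′ j′ ≟ col i j)))) (i , j , j∈Ki , refl))

used⁻ : ∀ {n q k} (col : Colouring n q k) K {c} → T (used col K c) → ∃₂ λ i j → j ∈ K i × col i j ≡ c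
used⁻ col K {c} usedc = does⇒ (any? (λ i → any? (λ j → (j ∈? K i) ×-dec (col i j ≟ c))))
  (subst T (lookup∘tabulate _ c) usedc)

initial : ℕ → (q : ℕ) → Subset q
initial zero    q       = ⊥
initial (suc p) zero    = []
initial (suc p) (suc q) = inside ∷ initial p q

∣initial∣ : ∀ {p q} → p ≤ q → ∣ initial p q ∣ ≡ p
∣initial∣ {zero}  {q}     _         = ∣⊥∣≡0 q
∣initial∣ {suc p} {suc q} (s≤s p≤q) = cong suc (∣initial∣ p≤q)

edgeOn : ∀ {n q} → (Fin n → Bool) → List ℕ → VSubset n q
edgeOn     S []       _       = ⊥
edgeOn {q = q} S (x ∷ xs) zero = if S zero then initial x q else ⊥
edgeOn     S (x ∷ xs) (suc i) = edgeOn (S ∘ suc) (if S zero then xs else x ∷ xs) i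

edgeOn-⊆ : ∀ {n q} (S : Fin n → Bool) σ i {j : Fin q} → j ∈ edgeOn S σ i → T (S i)
edgeOn-⊆ S []       i       j∈ = ⊥-elim (∉⊥ j∈)
edgeOn-⊆ S (x ∷ xs) zero    j∈ with S zero
... | true  = tt
... | false = ⊥-elim (∉⊥ j∈)
edgeOn-⊆ S (x ∷ xs) (suc i) j∈ = edgeOn-⊆ (S ∘ suc) (if S zero then xs else x ∷ xs) i j∈

nonzero-edgeOn : ∀ {n q} (S : Fin n → Bool) σ → count S ≡ length σ → All (1 ≤_) σ → All (_≤ q) σ →
  filter (1 ≤?_) (tabulate (λ i → ∣ edgeOn {q = q} S σ i ∣)) ≡ σ
nonzero-edgeOn {n} {q} S [] _ _ _ =
  filter-none (1 ≤?_) (tabulate⁺ {n = n} (λ _ → subst (λ x → ¬ 1 ≤ x) (sym (∣⊥∣≡0 q)) λ ()))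
nonzero-edgeOn {suc n} {q} S (x ∷ xs) #S (1≤x ∷ pos) (x≤q ∷ fit) with S zero
nonzero-edgeOn {suc n} {q} S (suc x ∷ xs) #S (_ ∷ pos) (x≤q ∷ fit) | true rewrite ∣initial∣ x≤q =
  cong (suc x ∷_) (nonzero-edgeOn (S ∘ suc) xs (suc-injective #S) pos fit)
... | false rewrite ∣⊥∣≡0 q = nonzero-edgeOn (S ∘ suc) (x ∷ xs) #S (1≤x ∷ pos) (x≤q ∷ fit)

sum-nonzero : ∀ xs → List.sum (filter (1 ≤?_) xs) ≡ List.sum xs
sum-nonzero []           = refl
sum-nonzero (zero  ∷ xs) = sum-nonzero xs
sum-nonzero (suc x ∷ xs) = cong (suc x +_) (sum-nonzero xs)

edgeOn-isEdge : ∀ {n r q σ} (S : Fin n → Bool) → IsPartition σ r → All (_≤ q) σ → count S ≡ s σ →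
  IsEdge n r q σ (edgeOn S σ)
edgeOn-isEdge {n} {r} {q} {σ} S (pos , ∑σ) fit #S = size , ↭-reflexive nonzero
  where
  sizes = tabulate (λ i → ∣ edgeOn {q = q} S σ i ∣)
  sizes≡ : map (λ i → ∣ edgeOn {q = q} S σ i ∣) (allFin n) ≡ sizes
  sizes≡ = map-tabulate id (λ i → ∣ edgeOn S σ i ∣)
  nonzero : nonzeroCards (edgeOn {q = q} S σ) ≡ σ
  nonzero = trans (cong (filter (1 ≤?_)) sizes≡) (nonzero-edgeOn S σ #S pos fit)
  size : card (edgeOn {q = q} S σ) ≡ r
  size = begin
    card (edgeOn S σ)                    ≡⟨ cong List.sum sizes≡ ⟩
    List.sum sizes                       ≡⟨ sum-nonzero sizes ⟨
    List.sum (filter (1 ≤?_) sizes)      ≡⟨ cong List.sum (nonzero-edgeOn S σ #S pos fit) ⟩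
    List.sum σ                           ≡⟨ ∑σ ⟩
    r                                    ∎
    where open ≡-Reasoning

monoZone⇒sparseSurjection : ∀ {σ r n q d β k} → IsPartition σ r → All (_≤ suc q) σ →
  InMonoZone n r (suc q) σ (suc d) β k → ∃ λ (f : Fin n → Fin k) → Onto f × Sparse d (s σ) f
monoZone⇒sparseSurjection {σ} {d = d} isPartition fit (col , (surj , edges) , mono) = f , onto , sparse
  where
  f = λ i → col i zero
  onto : Onto f
  onto c = let ((i , j) , colij≡c) = surj c in i , trans (mono i zero j) colij≡c
  sparse : Sparse d (s σ) f
  sparse W #W≤d with s σ ≤? count (W ∘ f)
  ... | no  ≰ = ≰⇒> ≰
  ... | yes ≤#f⁻¹W =
    contradiction (proj₁ (edges K (edgeOn-isEdge S isPartition fit #S))) (≤⇒≯ fewColours)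
    where
    chosen = subsetOfSize (W ∘ f) (s σ) ≤#f⁻¹W
    S = proj₁ chosen
    S⊆f⁻¹W = proj₁ (proj₂ chosen)
    #S = proj₂ (proj₂ chosen)
    K = edgeOn S σ
    usedOnlyW : used col K ⊆ᵇ W
    usedOnlyW c usedc with used⁻ col K usedc
    ... | i , j , j∈Ki , refl = subst (T ∘ W) (mono i zero j) (S⊆f⁻¹W i (edgeOn-⊆ S σ i j∈Ki))
    fewColours : numColours col K ≤ d
    fewColours = ≤-trans (≤-reflexive (numColours≡count col K)) (≤-trans (count-mono usedOnlyW) #W≤d)

sparseSurjection⇒monoZone : ∀ {σ r n q d β k} → s σ ≤ β →
  (f : Fin n → Fin k) → Onto f → Sparse d (s σ) f → InMonoZone n r (suc q) σ (suc d) β k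
sparseSurjection⇒monoZone {σ} {d = d} {β} s≤β f onto sparse = col , (surj , edges) , (λ _ _ _ → refl)
  where
  col = λ i _ → f i
  surj = λ c → let (i , fi≡c) = onto c in (i , zero) , fi≡c
  edges : ∀ K → IsEdge _ _ _ σ K → suc d ≤ numColours col K × numColours col K ≤ β
  edges K isEdge = manyColours , fewColours
    where
    #touched = count-touched K isEdge
    touched⇒used : touched K ⊆ᵇ used col K ∘ f
    touched⇒used i t with ∣p∣>0⇒∈ (K i) (does⇒ (1 ≤? ∣ K i ∣) t)
    ... | j , j∈Ki = used⁺ col K j∈Ki
    used⇒touched : ∀ c → T (used col K c) → ∃ λ i → T (touched K i) × f i ≡ c
    used⇒touched c usedc with used⁻ col K usedc
    ... | i , j , j∈Ki , fi≡c = i , ⇒does (1 ≤? ∣ K i ∣) (∈⇒∣p∣>0 j∈Ki) , fi≡c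
    fewColours : numColours col K ≤ β
    fewColours = begin
      numColours col K    ≡⟨ numColours≡count col K ⟩
      count (used col K)  ≤⟨ count-image-≤ f (touched K) (used col K) used⇒touched ⟩
      count (touched K)   ≡⟨ #touched ⟩
      s σ                 ≤⟨ s≤β ⟩
      β                   ∎
      where open ≤-Reasoning
    manyColours : suc d ≤ numColours col K
    manyColours with suc d ≤? numColours col K
    ... | yes many = many
    ... | no  few  = contradiction (subst (_≤ count (used col K ∘ f)) #touched (count-mono touched⇒used))
                       (<⇒≱ (sparse (used col K) (subst (_≤ d) (numColours≡count col K) (≤-pred (≰⇒> few)))))

-- The ceiling bound

ceilDiv-≤⇔ : ∀ x m k → 0 < m → ceilDiv x m ≤ k ⇔ x ≤ k * m
ceilDiv-≤⇔ x (suc m′) k _ = mk⇔ upper lower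
  where
  open ≤-Reasoning
  upper : (x + m′) / suc m′ ≤ k → x ≤ k * suc m′
  upper ⌈x/m⌉≤k = +-cancelʳ-≤ m′ x (k * suc m′) (begin
    x + m′                                         ≡⟨ m≡m%n+[m/n]*n (x + m′) (suc m′) ⟩
    (x + m′) % suc m′ + (x + m′) / suc m′ * suc m′
      ≤⟨ +-mono-≤ (≤-pred (m%n<n (x + m′) (suc m′))) (*-monoˡ-≤ (suc m′) ⌈x/m⌉≤k) ⟩
    m′ + k * suc m′                                ≡⟨ +-comm m′ (k * suc m′) ⟩
    k * suc m′ + m′                                ∎)
  lower : x ≤ k * suc m′ → (x + m′) / suc m′ ≤ k
  lower x≤km = ≤-pred (m<n*o⇒m/o<n (begin-strict
    x + m′              ≤⟨ +-monoˡ-≤ m′ x≤km ⟩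
    k * suc m′ + m′     <⟨ +-monoʳ-< (k * suc m′) ≤-refl ⟩
    k * suc m′ + suc m′ ≡⟨ +-comm (k * suc m′) (suc m′) ⟩
    suc k * suc m′      ∎))

∸-≤⇔ : ∀ {n R t} → R ≤ n → n ∸ R ≤ t ⇔ n ≤ t + R
∸-≤⇔ {n} {R} {t} R≤n = mk⇔
  (λ n∸R≤t → subst (_≤ t + R) (m∸n+n≡m R≤n) (+-monoˡ-≤ R n∸R≤t))
  (λ n≤t+R → subst (n ∸ R ≤_) (m+n∸n≡m t R) (∸-monoˡ-≤ R n≤t+R))

lowerBound-≤⇔ : ∀ n t d k .{{_ : NonZero d}} → d < t → (t ∸ 1) % d ≤ n →
  lowerBound n t (suc d) ≤ k ⇔ n ≤ k * ((t ∸ 1) / d) + (t ∸ 1) % d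
lowerBound-≤⇔ n (suc ℓ) d@(suc _) k (s≤s d≤ℓ) R≤n =
  subst (λ R → ceilDiv (n ∸ R) (ℓ / d) ≤ k ⇔ n ≤ k * (ℓ / d) + ℓ % d) remainder
    (⇔-trans (ceilDiv-≤⇔ (n ∸ ℓ % d) (ℓ / d) k (m≥n⇒m/n>0 d≤ℓ)) (∸-≤⇔ R≤n))
  where
  remainder : ℓ % d ≡ ℓ ∸ d * (ℓ / d)
  remainder = trans (m%n≡m∸m/n*n ℓ d) (cong (ℓ ∸_) (*-comm (ℓ / d) d))

m≡n*[m/n]+m%n : ∀ ℓ d .{{_ : NonZero d}} → ℓ ≡ d * (ℓ / d) + ℓ % d
m≡n*[m/n]+m%n ℓ d =
  trans (m≡m%n+[m/n]*n ℓ d) (trans (+-comm (ℓ % d) (ℓ / d * d)) (cong (_+ ℓ % d) (*-comm (ℓ / d) d)))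

theorem3p1 : (σ : List ℕ) (r n q α β : ℕ) →
    1 ≤ r → IsPartition σ r → 1 ≤ n → 1 ≤ q →
    s σ ≤ n → All (λ x → x ≤ q) σ →
    2 ≤ α → α ≤ β → α ≤ s σ → s σ ≤ β →
    (k : ℕ) → InMonoZone n r q σ α β k ⇔ (lowerBound n (s σ) α ≤ k × k ≤ n)
theorem3p1 _ _ _ zero    _                 _ _ _ _ ()  _ _ _         _ _ _ _
theorem3p1 _ _ _ (suc _) zero              _ _ _ _ _   _ _ ()        _ _ _ _
theorem3p1 _ _ _ (suc _) (suc zero)        _ _ _ _ _   _ _ (s≤s ())  _ _ _ _
theorem3p1 σ r n (suc q) (suc d@(suc _)) β _ isPartition _ _ s≤n fit _ _ d<s s≤β k = mk⇔
  (λ zone →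
    let (f , onto , sparse) = monoZone⇒sparseSurjection isPartition fit zone
        (k≤n , n≤) = sparseSurjection⇒bounds d m R R<d dm+R<n f onto (subst (λ t → Sparse d t f) s≡ sparse)
    in Equivalence.from bound⇔ n≤ , k≤n)
  (λ (lb , k≤n) →
    let (f , onto , sparse) = bounds⇒sparseSurjection k d m R R<d dm+R<n k≤n (Equivalence.to bound⇔ lb)
    in sparseSurjection⇒monoZone s≤β f onto (subst (λ t → Sparse d t f) (sym s≡) sparse))
  where
  ℓ = s σ ∸ 1
  m = ℓ / d
  R = ℓ % d
  R<d = m%n<n ℓ d
  s≡ : s σ ≡ suc (d * m + R)
  s≡ = trans (sym (trans (+-comm 1 ℓ) (m∸n+n≡m (≤-trans (s≤s z≤n) d<s))))
             (cong suc (m≡n*[m/n]+m%n ℓ d))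
  dm+R<n : d * m + R < n
  dm+R<n = subst (_≤ n) s≡ s≤n
  bound⇔ = lowerBound-≤⇔ n (s σ) d k d<s (≤-trans (m≤n+m R (d * m)) (<⇒≤ dm+R<n))
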